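{- Let $G$ be a $d$-$(u,v)$-universally diametrical graph of order $n$ such that $2d^2+9d+6\geq n$. Let $G^*$ be the graph obtained from $G$ by attaching a new pendant vertex $u'$ to $u$ and a new pendant vertex $v'$ to $v$. If $E_1(G)>W(G)$, then $E_1(G^*)>W(G^*)$.
   Context: All graphs are finite, simple, connected. $\varepsilon_G(w)=\max_x d_G(w,x)$ is the eccentricity, ${\rm diam}(G)=\max_w\varepsilon_G(w)$, and ${\rm Ecc}_G(w)=\{x: d_G(w,x)=\varepsilon_G(w)\}$ is the eccentric set of $w$. Vertices $u,v$ are diametrical if $d_G(u,v)={\rm diam}(G)$. $G$ is universally diametrical with universally diametrical pair $u,v$ if $u,v$ are diametrical vertices and ${\rm Ecc}_G(w)\cap\{u,v\}\neq\emptyset$ for every $w\in V(G)\setminus\{u,v\}$; it is $d$-$(u,v)$-universally diametrical if in addition $d_G(u,v)={\rm diam}(G)=d$. $E_1(G)=\sum_w\varepsilon_G(w)^2$ and $W(G)=\sum_{\{x,y\}\subseteq V(G)}d_G(x,y)$ is the Wiener index. -}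

module Defs where

open import Data.Nat using (ℕ; zero; suc; _+_; _*_; _⊔_; _<ᵇ_)
open import Data.Bool using (Bool; true; false; _∧_; _∨_; if_then_else_; not)
open import Data.Fin using (Fin; zero; suc; toℕ)
open import Data.Fin.Properties using (_≟_)
open import Data.List using (List; foldr; map)
open import Data.Nat.ListAction using (sum)
open import Data.Bool.ListAction using (any)
open import Data.List.Base using (allFin)
open import Data.Product using (_×_)
open import Data.Sum using (_⊎_)
open import Relation.Nullary using (¬_)
open import Relation.Nullary.Decidable using (⌊_⌋)
open import Relation.Binary.PropositionalEquality using (_≡_; _≢_)

Adj : ℕ → Set
Adj n = Fin n → Fin n → Bool

IsSimple : ∀ {n} → Adj n → Set
IsSimple {n} A = (∀ x y → A x y ≡ A y x) × (∀ x → A x x ≡ false)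

reach : ∀ {n} → Adj n → ℕ → Fin n → Fin n → Bool
reach A zero    x y = ⌊ x ≟ y ⌋
reach A (suc k) x y = reach A k x y ∨ any (λ z → A x z ∧ reach A k z y) (allFin _)

IsConnected : ∀ {n} → Adj n → Set
IsConnected {n} A = ∀ x y → reach A n x y ≡ true

leastFrom : ∀ {n} → Adj n → Fin n → Fin n → ℕ → ℕ → ℕ
leastFrom A x y k zero       = k
leastFrom A x y k (suc fuel) = if reach A k x y then k else leastFrom A x y (suc k) fuel

-- distance d_G(x,y): length of a shortest x–y path (for connected graphs,
-- a shortest walk has at most n edges, so the search over 0..n suffices)
dist : ∀ {n} → Adj n → Fin n → Fin n → ℕ
dist {n} A x y = leastFrom A x y 0 n

maxList : List ℕ → ℕ
maxList = foldr _⊔_ 0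

ecc : ∀ {n} → Adj n → Fin n → ℕ
ecc {n} A w = maxList (map (dist A w) (allFin n))

diam : ∀ {n} → Adj n → ℕ
diam {n} A = maxList (map (ecc A) (allFin n))

InEcc : ∀ {n} → Adj n → Fin n → Fin n → Set
InEcc A w x = dist A w x ≡ ecc A w

UnivDiam : ∀ {n} → Adj n → ℕ → Fin n → Fin n → Set
UnivDiam A d u v =
  (dist A u v ≡ diam A) × (diam A ≡ d) ×
  (∀ w → w ≢ u → w ≢ v → InEcc A w u ⊎ InEcc A w v)

E1 : ∀ {n} → Adj n → ℕ
E1 {n} A = sum (map (λ w → ecc A w * ecc A w) (allFin n))

-- Wiener index: sum over unordered pairs {x,y} (x ≠ y), taken as toℕ x < toℕ y
wiener : ∀ {n} → Adj n → ℕ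
wiener {n} A =
  sum (map (λ x → sum (map (λ y → if toℕ x <ᵇ toℕ y then dist A x y else 0)
                           (allFin n)))
           (allFin n))

-- G*: new vertices zero (= u') and suc zero (= v'); old vertex i is suc (suc i).
-- u' is a pendant attached to u, v' a pendant attached to v.
attachPendants : ∀ {n} → Adj n → Fin n → Fin n → Adj (suc (suc n))
attachPendants A u v zero          zero          = false
attachPendants A u v zero          (suc zero)    = false
attachPendants A u v zero          (suc (suc j)) = ⌊ j ≟ u ⌋
attachPendants A u v (suc zero)    zero          = false
attachPendants A u v (suc zero)    (suc zero)    = false
attachPendants A u v (suc zero)    (suc (suc j)) = ⌊ j ≟ v ⌋
attachPendants A u v (suc (suc i)) zero          = ⌊ i ≟ u ⌋
attachPendants A u v (suc (suc i)) (suc zero)    = ⌊ i ≟ v ⌋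
attachPendants A u v (suc (suc i)) (suc (suc j)) = A i j

-- Distances in G* are read off from G: the old vertices keep their distances
-- (G embeds in G* and G* retracts onto G, both without increasing distances), a
-- pendant vertex is one step further than its anchor, and d*(u′,v′) = d + 2.
-- Hence W(G*) = W(G) + (d + 2) + Σ_j (2 + d(u,j) + d(v,j)).  Universal
-- diametricity gives every vertex of G an eccentric vertex among u, v, so every
-- old eccentricity grows by one, while u′ and v′ have eccentricity at least d + 2.
-- With Σ_j d(u,j) + d ≤ Σ_j ε(j) (and the same for v) the termwise comparison
-- leaves E_1(G) > W(G) and n ≤ 2d² + 9d + 6 as the only requirements.

module Submission where

open import Defs
open import Data.Bool using (true; false; T; if_then_else_)
open import Data.Bool.Properties using (T-∨; T-∧; T-≡)
open import Data.Fin using (Fin; zero; suc; toℕ)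
open import Data.Fin.Properties using (_≟_)
open import Data.List using (_∷_; map; tabulate; allFin)
open import Data.List.Membership.Propositional using (_∈_; lose)
open import Data.List.Membership.Propositional.Properties using (∈-map⁺; ∈-allFin)
open import Data.List.Properties using (map-tabulate)
open import Data.List.Relation.Unary.Any using (here; there; satisfied)
open import Data.List.Relation.Unary.Any.Properties using (any⁺; any⁻)
open import Data.Nat using (ℕ; zero; suc; _+_; _*_; _≤_; _<_; _>_; _<ᵇ_; z≤n; s≤s)
open import Data.Nat.ListAction using (sum)
open import Data.Nat.Properties hiding (_≟_)
open import Data.Nat.Tactic.RingSolver using (solve-∀)
open import Data.Product using (_×_; _,_; ∃-syntax)
open import Data.Sum using (_⊎_; inj₁; inj₂)
open import Function using (_∘_; Equivalence)
open import Relation.Nullary.Decidable using (yes; no; toWitness; fromWitness)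
open import Relation.Binary.PropositionalEquality

open Equivalence using (to; from)
open import Algebra.Properties.CommutativeMonoid.Sum +-0-commutativeMonoid
  using (sum-syntax; sum-cong-≗; ∑-distrib-+) renaming (sum to ∑)
open import Algebra.Properties.CommutativeSemigroup +-commutativeSemigroup
  using (x∙yz≈y∙xz; xy∙z≈xz∙y)

sum-tabulate : ∀ {n} (f : Fin n → ℕ) → sum (tabulate f) ≡ ∑[ i < n ] f i
sum-tabulate {zero}  f = refl
sum-tabulate {suc n} f = cong (f zero +_) (sum-tabulate (f ∘ suc))

sum-map-allFin : ∀ {n} (f : Fin n → ℕ) → sum (map f (allFin n)) ≡ ∑[ i < n ] f i
sum-map-allFin f = trans (cong sum (map-tabulate (λ i → i) f)) (sum-tabulate f)

∑-suc : ∀ {n} (f : Fin n → ℕ) → ∑[ i < n ] suc (f i) ≡ n + ∑[ i < n ] f i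
∑-suc {zero}  f = refl
∑-suc {suc n} f =
  cong suc (trans (cong (f zero +_) (∑-suc (f ∘ suc))) (x∙yz≈y∙xz (f zero) n _))

∑-mono-≤ : ∀ {n} {f g : Fin n → ℕ} → (∀ i → f i ≤ g i) → ∑[ i < n ] f i ≤ ∑[ i < n ] g i
∑-mono-≤ {zero}  f≤g = z≤n
∑-mono-≤ {suc n} f≤g = +-mono-≤ (f≤g zero) (∑-mono-≤ (f≤g ∘ suc))

∑-mono-≤-at : ∀ {n} {f g : Fin n → ℕ} k {c} → (∀ i → f i ≤ g i) → f k + c ≤ g k →
              ∑[ i < n ] f i + c ≤ ∑[ i < n ] g i
∑-mono-≤-at {suc n} {f} {g} zero {c} f≤g fk+c≤gk = begin
  f zero + ∑[ i < n ] f (suc i) + c   ≡⟨ xy∙z≈xz∙y (f zero) _ c ⟩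
  f zero + c + ∑[ i < n ] f (suc i)   ≤⟨ +-mono-≤ fk+c≤gk (∑-mono-≤ (f≤g ∘ suc)) ⟩
  g zero + ∑[ i < n ] g (suc i)       ∎
  where open ≤-Reasoning
∑-mono-≤-at {suc n} {f} (suc k) {c} f≤g fk+c≤gk =
  ≤-trans (≤-reflexive (+-assoc (f zero) _ c))
          (+-mono-≤ (f≤g zero) (∑-mono-≤-at k (f≤g ∘ suc) fk+c≤gk))

∑-suc-square : ∀ {n} (f : Fin n → ℕ) →
               n + ∑[ i < n ] (suc (f i) * suc (f i))
               ≡ ∑[ i < n ] suc (f i) + ∑[ i < n ] suc (f i) + ∑[ i < n ] (f i * f i)
∑-suc-square {n} f = begin
  n + ∑[ i < n ] (suc (f i) * suc (f i))        ≡⟨ ∑-suc (λ i → suc (f i) * suc (f i)) ⟨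
  ∑[ i < n ] suc (suc (f i) * suc (f i))        ≡⟨ sum-cong-≗ (λ i → square-expand (f i)) ⟩
  ∑[ i < n ] (suc (f i) + suc (f i) + f i * f i) ≡⟨ ∑-distrib-+ (λ i → suc (f i) + suc (f i)) _ ⟩
  ∑[ i < n ] (suc (f i) + suc (f i)) + ∑[ i < n ] (f i * f i)
    ≡⟨ cong (_+ ∑[ i < n ] (f i * f i)) (∑-distrib-+ (λ i → suc (f i)) (λ i → suc (f i))) ⟩
  ∑[ i < n ] suc (f i) + ∑[ i < n ] suc (f i) + ∑[ i < n ] (f i * f i) ∎
  where
  open ≡-Reasoning
  square-expand : ∀ m → suc (suc m * suc m) ≡ suc m + suc m + m * m
  square-expand = solve-∀

E1≡∑ : ∀ {n} (A : Adj n) → E1 A ≡ ∑[ w < n ] (ecc A w * ecc A w)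
E1≡∑ A = sum-map-allFin (λ w → ecc A w * ecc A w)

wiener≡∑ : ∀ {n} (A : Adj n) →
           wiener A ≡ ∑[ x < n ] ∑[ y < n ] (if toℕ x <ᵇ toℕ y then dist A x y else 0)
wiener≡∑ {n} A = trans (sum-map-allFin row) (sum-cong-≗ (λ x → sum-map-allFin (summand x)))
  where
  summand : Fin n → Fin n → ℕ
  summand x y = if toℕ x <ᵇ toℕ y then dist A x y else 0
  row : Fin n → ℕ
  row x = sum (map (summand x) (allFin n))

maxList-upper : ∀ {x xs} → x ∈ xs → x ≤ maxList xs
maxList-upper (here refl) = m≤m⊔n _ _
maxList-upper {xs = y ∷ _} (there x∈xs) = m≤n⇒m≤o⊔n y (maxList-upper x∈xs)

dist≤ecc : ∀ {n} (A : Adj n) w x → dist A w x ≤ ecc A w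
dist≤ecc A w x = maxList-upper (∈-map⁺ (dist A w) (∈-allFin x))

ecc≤diam : ∀ {n} (A : Adj n) w → ecc A w ≤ diam A
ecc≤diam A w = maxList-upper (∈-map⁺ (ecc A) (∈-allFin w))

record Reach {n} (A : Adj n) (k : ℕ) (x y : Fin n) : Set where
  constructor reached
  field walk : T (reach A k x y)

module _ {n} {A : Adj n} where

  reach-refl : ∀ {x} → Reach A 0 x x
  reach-refl = reached (fromWitness refl)

  reach-zero : ∀ {x y} → Reach A 0 x y → x ≡ y
  reach-zero (reached r) = toWitness r

  reach-suc : ∀ {k x y} → Reach A k x y → Reach A (suc k) x y
  reach-suc (reached r) = reached (from T-∨ (inj₁ r))

  reach-step : ∀ {k x z y} → T (A x z) → Reach A k z y → Reach A (suc k) x y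
  reach-step {z = z} xz (reached r) =
    reached (from T-∨ (inj₂ (any⁺ _ (lose (∈-allFin z) (from T-∧ (xz , r))))))

  reach-suc-inv : ∀ {k x y} → Reach A (suc k) x y →
                  Reach A k x y ⊎ ∃[ z ] T (A x z) × Reach A k z y
  reach-suc-inv (reached r) with to T-∨ r
  ... | inj₁ r′ = inj₁ (reached r′)
  ... | inj₂ r′ with satisfied (any⁻ _ (allFin n) r′)
  ... | z , xz∧r = let xz , r″ = to T-∧ xz∧r in inj₂ (z , xz , reached r″)

  reach-≤ : ∀ {k l x y} → k ≤ l → Reach A k x y → Reach A l x y
  reach-≤ {l = zero}  z≤n r = r
  reach-≤ {l = suc l} k≤l r with m≤n⇒m<n∨m≡n k≤l
  ... | inj₁ k<1+l = reach-suc (reach-≤ (≤-pred k<1+l) r)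
  ... | inj₂ refl  = r

  reach-++ : ∀ {k l x y z} → Reach A k x y → Reach A l y z → Reach A (k + l) x z
  reach-++ {zero} r s rewrite reach-zero r = s
  reach-++ {suc k} r s with reach-suc-inv r
  ... | inj₁ r′           = reach-suc (reach-++ r′ s)
  ... | inj₂ (w , xw , r′) = reach-step xw (reach-++ r′ s)

  reach-sym : (∀ x y → A x y ≡ A y x) → ∀ {k x y} → Reach A k x y → Reach A k y x
  reach-sym symA {zero} r rewrite reach-zero r = reach-refl
  reach-sym symA {suc k} {x} {y} r with reach-suc-inv r
  ... | inj₁ r′           = reach-suc (reach-sym symA r′)
  ... | inj₂ (w , xw , r′) =
    subst (λ m → Reach A m y x) (+-comm k 1)
      (reach-++ (reach-sym symA r′) (reach-step (subst T (symA x w) xw) reach-refl))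

  private
    leastFrom-≤ : ∀ {x y s k} f → s ≤ k → Reach A k x y → leastFrom A x y s f ≤ k
    leastFrom-≤         zero    s≤k r = s≤k
    leastFrom-≤ {x} {y} {s} (suc f) s≤k r with reach A s x y in e | m≤n⇒m<n∨m≡n s≤k
    ... | true  | _         = s≤k
    ... | false | inj₁ s<k  = leastFrom-≤ f s<k r
    ... | false | inj₂ refl with () ← trans (sym e) (to T-≡ (Reach.walk r))

    leastFrom-reach : ∀ {x y} s f → Reach A (s + f) x y → Reach A (leastFrom A x y s f) x y
    leastFrom-reach s zero r = subst (λ m → Reach A m _ _) (+-identityʳ s) r
    leastFrom-reach {x} {y} s (suc f) r with reach A s x y in e
    ... | true  = reached (from T-≡ e)
    ... | false = leastFrom-reach (suc s) f (subst (λ m → Reach A m x y) (+-suc s f) r)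

  dist-≤ : ∀ {k x y} → Reach A k x y → dist A x y ≤ k
  dist-≤ = leastFrom-≤ n z≤n

  dist-reach : IsConnected A → ∀ x y → Reach A (dist A x y) x y
  dist-reach con x y = leastFrom-reach 0 n (reached (from T-≡ (con x y)))

  dist-refl : ∀ x → dist A x x ≡ 0
  dist-refl x = n≤0⇒n≡0 (dist-≤ reach-refl)

  dist-sym : (∀ x y → A x y ≡ A y x) → IsConnected A → ∀ x y → dist A x y ≡ dist A y x
  dist-sym symA con x y = ≤-antisym (dist-≤ (reach-sym symA (dist-reach con y x)))
                                    (dist-≤ (reach-sym symA (dist-reach con x y)))

  ∑suc-dist+dist≤∑suc-ecc : (∀ x y → A x y ≡ A y x) → IsConnected A → ∀ x y →
                            ∑[ j < n ] suc (dist A x j) + dist A x y ≤ ∑[ j < n ] suc (ecc A j)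
  ∑suc-dist+dist≤∑suc-ecc symA con x y = ∑-mono-≤-at x
    (λ j → s≤s (subst (_≤ ecc A j) (dist-sym symA con j x) (dist≤ecc A j x)))
    (subst (λ m → suc m + dist A x y ≤ suc (ecc A x)) (sym (dist-refl x)) (s≤s (dist≤ecc A x y)))

  diametrical-eccentric : ∀ {x y} → dist A x y ≡ diam A → InEcc A x y
  diametrical-eccentric {x} {y} xy≡diam =
    ≤-antisym (dist≤ecc A x y) (subst (ecc A x ≤_) (sym xy≡diam) (ecc≤diam A x))

  univDiam-eccentric : (∀ x y → A x y ≡ A y x) → IsConnected A → ∀ {d u v} →
                       UnivDiam A d u v → ∀ j → InEcc A j u ⊎ InEcc A j v
  univDiam-eccentric symA con {u = u} {v} (uv≡diam , _ , univ) j with j ≟ u | j ≟ v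
  ... | yes refl | _        = inj₂ (diametrical-eccentric uv≡diam)
  ... | no _     | yes refl = inj₁ (diametrical-eccentric (trans (dist-sym symA con v u) uv≡diam))
  ... | no j≢u   | no j≢v   = univ j j≢u j≢v

  pendant-walk : ∀ {a b} → (∀ z → T (A a z) → z ≡ b) →
                 ∀ {k y} → Reach A k a y → a ≢ y → ∃[ k′ ] k ≡ suc k′ × Reach A k′ b y
  pendant-walk only {zero} r a≢y with () ← a≢y (reach-zero r)
  pendant-walk only {suc k} r a≢y with reach-suc-inv r
  ... | inj₁ r′ with pendant-walk only r′ a≢y
  ...   | k′ , refl , r″ = suc k′ , refl , reach-suc r″
  pendant-walk only {suc k} r a≢y | inj₂ (z , az , r′) with refl ← only z az = k , refl , r′

  dist-pendant : IsConnected A → ∀ {a b} → (∀ z → T (A a z) → z ≡ b) → T (A a b) →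
                 ∀ {y} → a ≢ y → dist A a y ≡ suc (dist A b y)
  dist-pendant con only ab {y} a≢y with pendant-walk only (dist-reach con _ y) a≢y
  ... | k′ , d≡1+k′ , r = ≤-antisym (dist-≤ (reach-step ab (dist-reach con _ y)))
                                    (subst (suc (dist A _ y) ≤_) (sym d≡1+k′) (s≤s (dist-≤ r)))

IsWeakHomomorphism : ∀ {m n} → Adj m → Adj n → (Fin m → Fin n) → Set
IsWeakHomomorphism A B f = ∀ x z → T (A x z) → f x ≡ f z ⊎ T (B (f x) (f z))

module _ {m n} {A : Adj m} {B : Adj n} {f : Fin m → Fin n} (hom : IsWeakHomomorphism A B f) where

  reach-map : ∀ {k x y} → Reach A k x y → Reach B k (f x) (f y)
  reach-map {zero} r rewrite reach-zero r = reach-refl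
  reach-map {suc k} {y = y} r with reach-suc-inv r
  ... | inj₁ r′ = reach-suc (reach-map r′)
  ... | inj₂ (z , xz , r′) with hom _ z xz
  ...   | inj₁ fx≡fz = reach-suc (subst (λ w → Reach B k w (f y)) (sym fx≡fz) (reach-map r′))
  ...   | inj₂ fxfz  = reach-step fxfz (reach-map r′)

  dist-map-≤ : IsConnected A → ∀ x y → dist B (f x) (f y) ≤ dist A x y
  dist-map-≤ con x y = dist-≤ (reach-map (dist-reach con x y))

pattern u′ = zero
pattern v′ = suc zero
pattern old i = suc (suc i)

module AttachPendants {n} (A : Adj n) (u v : Fin n) where

  A* : Adj (suc (suc n))
  A* = attachPendants A u v

  anchor : Fin (suc (suc n)) → Fin n
  anchor u′      = u
  anchor v′      = v
  anchor (old i) = i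

  attachPendants-symmetric : (∀ x y → A x y ≡ A y x) → ∀ x y → A* x y ≡ A* y x
  attachPendants-symmetric symA u′      u′      = refl
  attachPendants-symmetric symA u′      v′      = refl
  attachPendants-symmetric symA u′      (old j) = refl
  attachPendants-symmetric symA v′      u′      = refl
  attachPendants-symmetric symA v′      v′      = refl
  attachPendants-symmetric symA v′      (old j) = refl
  attachPendants-symmetric symA (old i) u′      = refl
  attachPendants-symmetric symA (old i) v′      = refl
  attachPendants-symmetric symA (old i) (old j) = symA i j

  old-hom : IsWeakHomomorphism A A* (λ i → old i)
  old-hom _ _ = inj₂

  anchor-hom : IsWeakHomomorphism A* A anchor
  anchor-hom u′      (old j) ju = inj₁ (sym (toWitness ju))
  anchor-hom v′      (old j) jv = inj₁ (sym (toWitness jv))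
  anchor-hom (old i) u′      iu = inj₁ (toWitness iu)
  anchor-hom (old i) v′      iv = inj₁ (toWitness iv)
  anchor-hom (old i) (old j) ij = inj₂ ij

  u′-pendant : ∀ z → T (A* u′ z) → z ≡ old u
  u′-pendant (old j) ju = cong old (toWitness ju)

  v′-pendant : ∀ z → T (A* v′ z) → z ≡ old v
  v′-pendant (old j) jv = cong old (toWitness jv)

  to-anchor : ∀ x → Reach A* 1 x (old (anchor x))
  to-anchor u′      = reach-step (fromWitness refl) reach-refl
  to-anchor v′      = reach-step (fromWitness refl) reach-refl
  to-anchor (old i) = reach-suc reach-refl

  from-anchor : ∀ x → Reach A* 1 (old (anchor x)) x
  from-anchor u′      = reach-step (fromWitness refl) reach-refl
  from-anchor v′      = reach-step (fromWitness refl) reach-refl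
  from-anchor (old i) = reach-suc reach-refl

  attachPendants-connected : IsConnected A → IsConnected A*
  attachPendants-connected con x y = to T-≡ (Reach.walk
    (reach-≤ (≤-reflexive (+-comm (suc n) 1))
      (reach-++ (reach-++ (to-anchor x) (reach-map old-hom (reached (from T-≡ (con _ _)))))
                (from-anchor y))))

  module _ (symA : ∀ x y → A x y ≡ A y x) (con : IsConnected A) where

    private
      con* : IsConnected A*
      con* = attachPendants-connected con

      symA* : ∀ x y → A* x y ≡ A* y x
      symA* = attachPendants-symmetric symA

    dist-old : ∀ i j → dist A* (old i) (old j) ≡ dist A i j
    dist-old i j = ≤-antisym (dist-map-≤ old-hom con i j) (dist-map-≤ anchor-hom con* (old i) (old j))

    dist-u′ : ∀ j → dist A* u′ (old j) ≡ suc (dist A u j)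
    dist-u′ j = trans (dist-pendant con* {u′} u′-pendant (fromWitness refl) {old j} (λ ()))
                      (cong suc (dist-old u j))

    dist-v′ : ∀ j → dist A* v′ (old j) ≡ suc (dist A v j)
    dist-v′ j = trans (dist-pendant con* {v′} v′-pendant (fromWitness refl) {old j} (λ ()))
                      (cong suc (dist-old v j))

    dist-u′v′ : dist A* u′ v′ ≡ suc (suc (dist A u v))
    dist-u′v′ = begin
      dist A* u′ v′             ≡⟨ dist-pendant con* {u′} u′-pendant (fromWitness refl) {v′} (λ ()) ⟩
      suc (dist A* (old u) v′)  ≡⟨ cong suc (dist-sym symA* con* (old u) v′) ⟩
      suc (dist A* v′ (old u))  ≡⟨ cong suc (dist-v′ u) ⟩
      suc (suc (dist A v u))    ≡⟨ cong (λ m → suc (suc m)) (dist-sym symA con v u) ⟩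
      suc (suc (dist A u v))    ∎
      where open ≡-Reasoning

    wiener-attachPendants :
      wiener A* ≡ (suc (suc (dist A u v)) + ∑[ j < n ] suc (dist A u j))
                  + (∑[ j < n ] suc (dist A v j) + wiener A)
    wiener-attachPendants = begin
      wiener A*
        ≡⟨ wiener≡∑ A* ⟩
      -- definitional: u′ and v′ come first in the order by toℕ, so their rows split off
      (dist A* u′ v′ + ∑[ j < n ] dist A* u′ (old j))
        + (∑[ j < n ] dist A* v′ (old j)
           + ∑[ i < n ] ∑[ j < n ] (if toℕ i <ᵇ toℕ j then dist A* (old i) (old j) else 0))
        ≡⟨ cong₂ _+_ (cong₂ _+_ dist-u′v′ (sum-cong-≗ dist-u′))
                     (cong₂ _+_ (sum-cong-≗ dist-v′) (sum-cong-≗ λ i → sum-cong-≗ λ j →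
                                  cong (if toℕ i <ᵇ toℕ j then_else 0) (dist-old i j))) ⟩
      (suc (suc (dist A u v)) + ∑[ j < n ] suc (dist A u j))
        + (∑[ j < n ] suc (dist A v j)
           + ∑[ i < n ] ∑[ j < n ] (if toℕ i <ᵇ toℕ j then dist A i j else 0))
        ≡⟨ cong ((suc (suc (dist A u v)) + ∑[ j < n ] suc (dist A u j)) +_)
                (cong (∑[ j < n ] suc (dist A v j) +_) (sym (wiener≡∑ A))) ⟩
      (suc (suc (dist A u v)) + ∑[ j < n ] suc (dist A u j))
        + (∑[ j < n ] suc (dist A v j) + wiener A)
        ∎
      where open ≡-Reasoning

    ecc-u′-≥ : suc (suc (dist A u v)) ≤ ecc A* u′
    ecc-u′-≥ = subst (_≤ ecc A* u′) dist-u′v′ (dist≤ecc A* u′ v′)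

    ecc-v′-≥ : suc (suc (dist A u v)) ≤ ecc A* v′
    ecc-v′-≥ = subst (_≤ ecc A* v′) (trans (dist-sym symA* con* v′ u′) dist-u′v′) (dist≤ecc A* v′ u′)

    private
      ecc-old-≥-via : ∀ {p w j} → dist A* p (old j) ≡ suc (dist A w j) → InEcc A j w →
                      suc (ecc A j) ≤ ecc A* (old j)
      ecc-old-≥-via {p} {w} {j} pj≡1+wj jw = subst (_≤ ecc A* (old j)) jp≡1+ecc (dist≤ecc A* (old j) p)
        where
        jp≡1+ecc : dist A* (old j) p ≡ suc (ecc A j)
        jp≡1+ecc = begin
          dist A* (old j) p   ≡⟨ dist-sym symA* con* (old j) p ⟩
          dist A* p (old j)   ≡⟨ pj≡1+wj ⟩
          suc (dist A w j)    ≡⟨ cong suc (dist-sym symA con w j) ⟩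
          suc (dist A j w)    ≡⟨ cong suc jw ⟩
          suc (ecc A j)       ∎
          where open ≡-Reasoning

    ecc-old-≥ : ∀ j → InEcc A j u ⊎ InEcc A j v → suc (ecc A j) ≤ ecc A* (old j)
    ecc-old-≥ j (inj₁ ju) = ecc-old-≥-via {u′} (dist-u′ j) ju
    ecc-old-≥ j (inj₂ jv) = ecc-old-≥-via {v′} (dist-v′ j) jv

    E1-attachPendants-≥ : (∀ j → InEcc A j u ⊎ InEcc A j v) →
      suc (suc (dist A u v)) * suc (suc (dist A u v))
      + (suc (suc (dist A u v)) * suc (suc (dist A u v)) + ∑[ j < n ] (suc (ecc A j) * suc (ecc A j)))
      ≤ E1 A*
    E1-attachPendants-≥ eccentric = subst (_≤_ _) (sym (E1≡∑ A*))
      (+-mono-≤ (*-mono-≤ ecc-u′-≥ ecc-u′-≥)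
        (+-mono-≤ (*-mono-≤ ecc-v′-≥ ecc-v′-≥)
          (∑-mono-≤ λ j → *-mono-≤ (ecc-old-≥ j (eccentric j)) (ecc-old-≥ j (eccentric j)))))

-- The surplus n + 2 − d of the new Wiener rows over the growth of Σ ε² is paid
-- for by the two new terms (d + 2)², which is exactly the hypothesis on n.
pendant-counting : ∀ {n D X Y S Q W E W* E*} →
  W* ≡ (suc (suc D) + X) + (Y + W) → W < E →
  X + D ≤ S → Y + D ≤ S → n + Q ≡ S + S + E →
  n ≤ 2 * D * D + 9 * D + 6 →
  suc (suc D) * suc (suc D) + (suc (suc D) * suc (suc D) + Q) ≤ E* → W* < E*
pendant-counting {n} {D} {X} {Y} {S} {Q} {W} {E} {W*} {E*} W*≡ W<E X+D≤S Y+D≤S n+Q≡ n≤ E*≥ =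
  +-cancelˡ-≤ (D + D) (suc W*) E* (begin
    D + D + suc W*                             ≡⟨ cong (λ w → D + D + suc w) W*≡ ⟩
    D + D + suc (suc (suc D) + X + (Y + W))    ≡⟨ regroup D X Y W ⟩
    suc (suc D) + ((X + D) + (Y + D) + suc W)  ≤⟨ +-monoʳ-≤ (suc (suc D)) (+-mono-≤ (+-mono-≤ X+D≤S Y+D≤S) W<E) ⟩
    suc (suc D) + (S + S + E)                  ≡⟨ cong (suc (suc D) +_) n+Q≡ ⟨
    suc (suc D) + (n + Q)                      ≤⟨ +-monoʳ-≤ (suc (suc D)) (+-monoˡ-≤ Q n≤) ⟩
    suc (suc D) + (2 * D * D + 9 * D + 6 + Q)  ≡⟨ complete-square D Q ⟩
    D + D + (suc (suc D) * suc (suc D) + (suc (suc D) * suc (suc D) + Q)) ≤⟨ +-monoʳ-≤ (D + D) E*≥ ⟩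
    D + D + E*                                 ∎)
  where
  open ≤-Reasoning
  regroup : ∀ D X Y W → D + D + suc (suc (suc D) + X + (Y + W)) ≡ suc (suc D) + ((X + D) + (Y + D) + suc W)
  regroup = solve-∀
  complete-square : ∀ D Q → suc (suc D) + (2 * D * D + 9 * D + 6 + Q)
                            ≡ D + D + (suc (suc D) * suc (suc D) + (suc (suc D) * suc (suc D) + Q))
  complete-square = solve-∀

theorem4p2 : (n d : ℕ) (A : Adj n) (u v : Fin n) →
    IsSimple A → IsConnected A → UnivDiam A d u v →
    n ≤ 2 * d * d + 9 * d + 6 →
    E1 A > wiener A →
    E1 (attachPendants A u v) > wiener (attachPendants A u v)
theorem4p2 n d A u v (symA , _) con ud@(uv≡diam , diam≡d , _) n≤ E1>W =
  pendant-counting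
    (wiener-attachPendants symA con)
    E1>W
    (∑suc-dist+dist≤∑suc-ecc symA con u v)
    (subst (λ m → ∑[ j < n ] suc (dist A v j) + m ≤ ∑[ j < n ] suc (ecc A j))
           (dist-sym symA con v u) (∑suc-dist+dist≤∑suc-ecc symA con v u))
    (trans (∑-suc-square (ecc A)) (cong (_+_ _) (sym (E1≡∑ A))))
    (subst (λ t → n ≤ 2 * t * t + 9 * t + 6) (sym (trans uv≡diam diam≡d)) n≤)
    (E1-attachPendants-≥ symA con (univDiam-eccentric symA con ud))
  where open AttachPendants A u v
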